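{- Let $q\in\mathbb{C}$, $s\in\mathbb{N}_0$, $\alpha_0,\dots,\alpha_s\in\mathbb{C}$, and let $X,Y$ satisfy $XY-qYX=\sum_{j=0}^s\alpha_jY^j$. Let $\mathscr{L}_{\boldsymbol{\alpha};q}(n;j,k)$ (the $q$-deformed polynomial Lah numbers) be the coefficient of $Y^jX^k$ in the normal ordered expansion of $(Y^2X)^n$, with value $0$ if $j<0$ or $k<0$. Then (i) for all $n\ge1$, $j\ge0$, $1\le k\le n$, $$\mathscr{L}_{\boldsymbol{\alpha};q}(n;j,k)=\sum_{\mathbf{k}\in\mathcal{WC}_{s+1}(n-k\,|\,j-2n)}m_{\mathbf{k}}(\mathcal{L}_n;q);$$ (ii) for all $n\ge0$, $j\ge2$, $k\ge0$, $$\mathscr{L}_{\boldsymbol{\alpha};q}(n+1;j,k)=q^{j-2}\mathscr{L}_{\boldsymbol{\alpha};q}(n;j-2,k-1)+\sum_{r=0}^s\alpha_r[j-r-1]_q\,\mathscr{L}_{\boldsymbol{\alpha};q}(n;j-r-1,k).$$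
   Context: The monomials $Y^jX^k$ form a basis of this algebra. $[m]_q=1+q+\cdots+q^{m-1}$ for $m\ge1$, $[m]_q=0$ for $m\le0$. $\mathcal{WC}_{s+1}(a\,|\,t)$ is the set of $\mathbf{k}=(k_0,\dots,k_s)\in\mathbb{N}_0^{s+1}$ with $\sum_jk_j=a$ and $\sum_{j=0}^s(j-1)k_j=t$. $\boldsymbol{\alpha}^{\mathbf{k}}=\prod_j\alpha_j^{k_j}$. The Lah board $\mathcal{L}_n$ has top-aligned columns of heights $2(n-1),2(n-2),\dots,2,0$ from left to right (board of $(Y^2X)^n$). Mixed rook placements (Goldman–Haglund row creation rule): for a board $B$ with columns of heights $h_1\ge\cdots\ge h_N\ge0$ (left to right), a mixed rook placement of type $\mathbf{k}$ is built by processing columns right to left; in each column place no rook or one rook of weight $w\in\{0,\dots,s\}$; a rook of weight $w$ occupies its row (unavailable to its left) and creates $w$ new rows extending all columns to its left. Concretely column $c$ has $a_c=h_c+\sum(w-1)$ available cells (sum over rooks already placed to its right), ordered bottom (position 1) to top, and a rook in column $c$ sits at position $p_c\in\{1,\dots,a_c\}$; exactly $k_w$ rooks have weight $w$. $\mathcal{M}_{\mathbf{k}}(B)$ is the set of these. Empty boxes: all $a_c$ available cells of a rook-free column, and the $p_c-1$ available cells below the rook otherwise. $m_{\mathbf{k}}(B;q)=\boldsymbol{\alpha}^{\mathbf{k}}\sum_{\phi\in\mathcal{M}_{\mathbf{k}}(B)}q^{\#\text{empty boxes}}$. -}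

module Defs where

open import Level using (Level)
open import Algebra.Bundles using (CommutativeRing)
open import Data.Nat as ℕ using (ℕ; zero; suc)
open import Data.Integer as ℤ using (ℤ; +_; -[1+_]; +[1+_])
open import Data.Fin as Fin using (Fin)
open import Data.Vec as Vec using (Vec)
import Data.Vec.Properties as VecP
open import Data.List as List using (List; []; _∷_; _++_)
open import Data.Product using (_×_; _,_)
open import Data.Bool using (Bool; true; false; _∧_)
open import Relation.Nullary using (does)
open import Relation.Binary.PropositionalEquality using (_≡_)

clamp : ℤ → ℕ
clamp (+ n) = n
clamp -[1+ _ ] = 0

boundedVecs : (m a : ℕ) → List (Vec ℕ m)
boundedVecs zero a = Vec.[] ∷ []
boundedVecs (suc m) a =
  List.concatMap (λ x → List.map (x Vec.∷_) (boundedVecs m a)) (List.upTo (suc a))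

wsum : ∀ {m} → Vec ℕ m → ℤ
wsum {m} v = List.foldr ℤ._+_ (+ 0)
  (List.map (λ i → (+ Fin.toℕ i ℤ.- + 1) ℤ.* + Vec.lookup v i) (List.allFin m))

WC : (s a : ℕ) (t : ℤ) → List (Vec ℕ (suc s))
WC s a t = List.filterᵇ
  (λ v → does (Vec.sum v ℕ.≟ a) ∧ does (wsum v ℤ.≟ t))
  (boundedVecs (suc s) a)

-- Lah board L_n : column heights 2(n-1), 2(n-2), …, 2, 0 from left to right.
lahBoard : ℕ → List ℕ
lahBoard n = List.reverse (List.map (λ i → 2 ℕ.* i) (List.upTo n))

data Letter : Set where
  X Y : Letter

lahWord : ℕ → List Letter
lahWord zero = []
lahWord (suc n) = Y ∷ Y ∷ X ∷ lahWord n

module Lah {c ℓ : Level} (R : CommutativeRing c ℓ)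
           (q : CommutativeRing.Carrier R) (s : ℕ)
           (α : Fin (suc s) → CommutativeRing.Carrier R) where
  open CommutativeRing R

  pow : Carrier → ℕ → Carrier
  pow x zero = 1#
  pow x (suc n) = x * pow x n

  sumL : List Carrier → Carrier
  sumL = List.foldr _+_ 0#

  -- [m]_q = 1 + q + … + q^{m-1} for m ≥ 1, 0 for m ≤ 0
  qint : ℤ → Carrier
  qint z = sumL (List.map (pow q) (List.upTo (clamp z)))

  -- Normal ordering in the algebra  XY - qYX = Σ_j α_j Y^j.
  -- An expression is a finite linear combination of monomials Y^j X^k,
  -- stored as a list of terms (coefficient, j, k).
  Expr : Set c
  Expr = List (Carrier × ℕ × ℕ)

  -- normal ordered form of X Y^m, using (XY)Y^m = (qYX + Σ α_r Y^r) Y^m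
  xY : ℕ → Expr
  xY zero = (1# , 0 , 1) ∷ []
  xY (suc m) =
    List.map (λ { (d , a , b) → (q * d , suc a , b) }) (xY m)
    ++ List.map (λ r → (α r , Fin.toℕ r ℕ.+ m , 0)) (List.allFin (suc s))

  mulY : Expr → Expr
  mulY = List.map (λ { (d , j , k) → (d , suc j , k) })

  mulX : Expr → Expr
  mulX = List.concatMap (λ { (d , j , k) →
           List.map (λ { (e , a , b) → (d * e , a , b ℕ.+ k) }) (xY j) })

  normal : List Letter → Expr
  normal [] = (1# , 0 , 0) ∷ []
  normal (X ∷ w) = mulX (normal w)
  normal (Y ∷ w) = mulY (normal w)

  coeff : Expr → ℕ → ℕ → Carrier
  coeff e j k = sumL (List.map (λ { (d , a , b) →
     if' (does (a ℕ.≟ j) ∧ does (b ℕ.≟ k)) d }) e)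
    where
    if' : Bool → Carrier → Carrier
    if' true d = d
    if' false d = 0#

  lah : ℕ → ℤ → ℤ → Carrier
  lah n (+ j) (+ k) = coeff (normal (lahWord n)) j k
  lah n (+ j) -[1+ _ ] = 0#
  lah n -[1+ _ ] k = 0#

  -- Mixed rook placements (Goldman–Haglund row creation rule).
  -- A placement records, for each column from right to left, either no rook
  -- or a rook of weight w at position p (1 ≤ p ≤ a_c).
  data Choice : Set where
    none : Choice
    rook : Fin (suc s) → ℕ → Choice

  -- all placements; heights listed right to left, e = Σ (w-1) over rooks placed so far
  placementsR : ℤ → List ℕ → List (List Choice)
  placementsR e [] = [] ∷ []
  placementsR e (h ∷ hs) =
    List.map (none ∷_) (placementsR e hs)
    ++ List.concatMap (λ w → List.concatMap (λ p →
         List.map (rook w p ∷_) (placementsR (e ℤ.+ (+ Fin.toℕ w ℤ.- + 1)) hs))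
           (List.map suc (List.upTo (clamp (+ h ℤ.+ e)))))
       (List.allFin (suc s))

  emptyR : ℤ → List ℕ → List Choice → ℕ
  emptyR e [] _ = 0
  emptyR e (h ∷ hs) [] = 0
  emptyR e (h ∷ hs) (none ∷ φ) = clamp (+ h ℤ.+ e) ℕ.+ emptyR e hs φ
  emptyR e (h ∷ hs) (rook w p ∷ φ) =
    (p ℕ.∸ 1) ℕ.+ emptyR (e ℤ.+ (+ Fin.toℕ w ℤ.- + 1)) hs φ

  typeOf : List Choice → Vec ℕ (suc s)
  typeOf φ = Vec.tabulate (λ w → List.length (List.filterᵇ (isW w) φ))
    where
    isW : Fin (suc s) → Choice → Bool
    isW w none = false
    isW w (rook v _) = does (w Fin.≟ v)

  placements : List ℕ → List (List Choice)
  placements B = placementsR (+ 0) (List.reverse B)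

  M : Vec ℕ (suc s) → List ℕ → List (List Choice)
  M κ B = List.filterᵇ (λ φ → does (VecP.≡-dec ℕ._≟_ (typeOf φ) κ)) (placements B)

  αpow : Vec ℕ (suc s) → Carrier
  αpow κ = List.foldr _*_ 1# (List.map (λ w → pow (α w) (Vec.lookup κ w)) (List.allFin (suc s)))

  m : Vec ℕ (suc s) → List ℕ → Carrier
  m κ B = αpow κ * sumL (List.map (λ φ → pow q (emptyR (+ 0) (List.reverse B) φ)) (M κ B))

  infix 4 _≈ᴿ_
  infixl 6 _+ᴿ_
  infixl 7 _*ᴿ_
  _≈ᴿ_ : Carrier → Carrier → Set ℓ
  _≈ᴿ_ = _≈_
  _+ᴿ_ _*ᴿ_ : Carrier → Carrier → Carrier
  _+ᴿ_ = _+_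
  _*ᴿ_ = _*_

{-# OPTIONS --safe #-}

-- Pair a normal-ordered expression E = Σ d Y^a X^b with a test function F : ℕ → ℕ → R by
-- ⟪ E , F ⟫ = Σ d F a b. The coefficient of Y^j X^k is the pairing with the delta function
-- coord j k, and left multiplication by Y²X is adjoint to an explicit operator Y²X† read off from
-- X Y^m = q^m Y^m X + [m]_q Σ_r α_r Y^(r+m-1). Evaluating Y²X† (coord j k) gives (ii).
--
-- For (i), sum the weights of mixed rook placements on a board whose column heights, read from
-- right to left, are h, h + 2, h + 4, ... One column at a time, this sum obeys the recursion of
-- Y²X†: an empty column with a available cells contributes q^a and raises the exponents (j, k)
-- by (2, 1), while a rook of weight w at position p contributes α_w q^(p-1) and raises j by w + 1,
-- and its a positions add up to [a]_q. Hence the placement sum on the Lah board is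
-- (Y²X†)^n (coord j k) at (0, 0), and a placement reaches Y^j X^k exactly when its type lies in
-- WC(n - k | j - 2n).
module Submission where

open import Defs
open import Level using (Level)
open import Algebra.Bundles using (CommutativeMonoid; Semiring; CommutativeRing)
open import Data.Bool using (Bool; true; false; _∧_; if_then_else_; T)
import Data.Bool.Properties as Bool
open import Data.Fin as Fin using (Fin; toℕ)
open import Data.Integer as ℤ using (ℤ; +_; -[1+_]; _-_)
import Data.Integer.Properties as ℤ
import Data.Integer.Tactic.RingSolver as ℤ-Solver
open import Data.List as List using (List; []; _∷_; _++_; map; foldr; concatMap; filterᵇ; allFin; upTo)
import Data.List.Properties as List
open import Data.List.Relation.Unary.All as All using (All; []; _∷_)
import Data.List.Relation.Unary.All.Properties as All
open import Data.Nat as ℕ using (ℕ; zero; suc; _∸_; _≤_; _<_; s≤s)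
import Data.Nat.Properties as ℕ
import Data.Nat.Tactic.RingSolver as ℕ-Solver
open import Data.Product using (_×_; _,_)
open import Data.Sum using (inj₁; inj₂)
open import Data.Vec as Vec using (Vec; []; _∷_)
import Data.Vec.Properties as Vec
open import Function using (_∘_; _⇔_; mk⇔)
open import Relation.Nullary using (does; yes; no)
open import Relation.Nullary.Decidable using (_×-dec_; does-⇔)
open import Relation.Binary.PropositionalEquality as ≡ using (_≡_)

private
  variable
    b c : Level
    A : Set b
    B : Set c

module ListSum {a ℓ} (M : CommutativeMonoid a ℓ) where
  open CommutativeMonoid M
  open import Relation.Binary.Reasoning.Setoid setoid

  ∑ : List A → (A → Carrier) → Carrier
  ∑ xs f = foldr _∙_ ε (map f xs)

  ∑-congᴬ : ∀ {xs} {f g : A → Carrier} → All (λ x → f x ≈ g x) xs → ∑ xs f ≈ ∑ xs g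
  ∑-congᴬ []          = refl
  ∑-congᴬ (fx≈gx ∷ p) = ∙-cong fx≈gx (∑-congᴬ p)

  ∑-cong : ∀ (xs : List A) {f g} → (∀ x → f x ≈ g x) → ∑ xs f ≈ ∑ xs g
  ∑-cong xs f≈g = ∑-congᴬ (All.universal f≈g xs)

  ∑-map : ∀ (g : B → A) xs (f : A → Carrier) → ∑ (map g xs) f ≡ ∑ xs (f ∘ g)
  ∑-map g xs f = ≡.cong (foldr _∙_ ε) (≡.sym (List.map-∘ xs))

  ∑-++ : ∀ (xs ys : List A) f → ∑ (xs ++ ys) f ≈ ∑ xs f ∙ ∑ ys f
  ∑-++ []       ys f = sym (identityˡ _)
  ∑-++ (x ∷ xs) ys f = trans (∙-congˡ (∑-++ xs ys f)) (sym (assoc _ _ _))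

  ∑-concatMap : ∀ (g : B → List A) xs f → ∑ (concatMap g xs) f ≈ ∑ xs (λ y → ∑ (g y) f)
  ∑-concatMap g []       f = refl
  ∑-concatMap g (y ∷ ys) f = trans (∑-++ (g y) (concatMap g ys) f) (∙-congˡ (∑-concatMap g ys f))

  ∑-ε : ∀ (xs : List A) {f} → (∀ x → f x ≈ ε) → ∑ xs f ≈ ε
  ∑-ε []       f≈ε = refl
  ∑-ε (x ∷ xs) f≈ε = trans (∙-cong (f≈ε x) (∑-ε xs f≈ε)) (identityˡ ε)

  ∑-distrib : ∀ (xs : List A) f g → ∑ xs (λ x → f x ∙ g x) ≈ ∑ xs f ∙ ∑ xs g
  ∑-distrib []       f g = sym (identityˡ ε)
  ∑-distrib (x ∷ xs) f g = begin
    (f x ∙ g x) ∙ ∑ xs (λ y → f y ∙ g y) ≈⟨ ∙-congˡ (∑-distrib xs f g) ⟩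
    (f x ∙ g x) ∙ (∑ xs f ∙ ∑ xs g)     ≈⟨ assoc _ _ _ ⟩
    f x ∙ (g x ∙ (∑ xs f ∙ ∑ xs g))     ≈⟨ ∙-congˡ (sym (assoc _ _ _)) ⟩
    f x ∙ ((g x ∙ ∑ xs f) ∙ ∑ xs g)     ≈⟨ ∙-congˡ (∙-congʳ (comm _ _)) ⟩
    f x ∙ ((∑ xs f ∙ g x) ∙ ∑ xs g)     ≈⟨ ∙-congˡ (assoc _ _ _) ⟩
    f x ∙ (∑ xs f ∙ (g x ∙ ∑ xs g))     ≈⟨ sym (assoc _ _ _) ⟩
    (f x ∙ ∑ xs f) ∙ (g x ∙ ∑ xs g)     ∎

  ∑-comm : ∀ (xs : List A) (ys : List B) (f : A → B → Carrier) →
           ∑ xs (λ x → ∑ ys (f x)) ≈ ∑ ys (λ y → ∑ xs (λ x → f x y))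
  ∑-comm []       ys f = sym (∑-ε ys (λ _ → refl))
  ∑-comm (x ∷ xs) ys f =
    trans (∙-congˡ (∑-comm xs ys f)) (sym (∑-distrib ys (f x) (λ y → ∑ xs (λ x′ → f x′ y))))

  ∑-filterᵇ : ∀ (p : A → Bool) xs f → ∑ (filterᵇ p xs) f ≈ ∑ xs (λ x → if p x then f x else ε)
  ∑-filterᵇ p []       f = refl
  ∑-filterᵇ p (x ∷ xs) f with p x
  ... | true  = ∙-congˡ (∑-filterᵇ p xs f)
  ... | false = trans (∑-filterᵇ p xs f) (sym (identityˡ _))

  ∑-allFin-suc : ∀ {n} f → ∑ (allFin (suc n)) f ≡ f Fin.zero ∙ ∑ (allFin n) (f ∘ Fin.suc)
  ∑-allFin-suc f = ≡.cong (λ xs → f Fin.zero ∙ foldr _∙_ ε xs)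
    (≡.trans (List.map-tabulate Fin.suc f) (≡.sym (List.map-tabulate (λ i → i) (f ∘ Fin.suc))))

  ∑-allFin-lookup : ∀ {n} (v : Vec Carrier n) → ∑ (allFin n) (Vec.lookup v) ≡ Vec.foldr′ _∙_ ε v
  ∑-allFin-lookup []      = ≡.refl
  ∑-allFin-lookup (x ∷ v) = ≡.trans (∑-allFin-suc (Vec.lookup (x ∷ v))) (≡.cong (x ∙_) (∑-allFin-lookup v))

  ∑-upTo-suc : ∀ n f → ∑ (upTo (suc n)) f ≡ f 0 ∙ ∑ (upTo n) (f ∘ suc)
  ∑-upTo-suc n f = ≡.cong (λ xs → f 0 ∙ foldr _∙_ ε xs)
    (≡.trans (List.map-applyUpTo suc f n) (≡.sym (List.map-applyUpTo (λ i → i) (f ∘ suc) n)))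

  ∑-allFin-δ : ∀ {n} (v : Fin n) x f →
               ∑ (allFin n) (λ w → if does (w Fin.≟ v) then x ∙ f w else f w) ≈ x ∙ ∑ (allFin n) f
  ∑-allFin-δ {suc n} Fin.zero x f = begin
    ∑ (allFin (suc n)) g                          ≡⟨ ∑-allFin-suc g ⟩
    (x ∙ f Fin.zero) ∙ ∑ (allFin n) (f ∘ Fin.suc) ≈⟨ assoc _ _ _ ⟩
    x ∙ (f Fin.zero ∙ ∑ (allFin n) (f ∘ Fin.suc)) ≡⟨ ≡.cong (x ∙_) (≡.sym (∑-allFin-suc f)) ⟩
    x ∙ ∑ (allFin (suc n)) f                       ∎
    where g = λ w → if does (w Fin.≟ Fin.zero) then x ∙ f w else f w
  ∑-allFin-δ {suc n} (Fin.suc v) x f = begin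
    ∑ (allFin (suc n)) g                          ≡⟨ ∑-allFin-suc g ⟩
    f Fin.zero ∙ ∑ (allFin n) (g ∘ Fin.suc)       ≈⟨ ∙-congˡ (∑-allFin-δ v x (f ∘ Fin.suc)) ⟩
    f Fin.zero ∙ (x ∙ ∑ (allFin n) (f ∘ Fin.suc)) ≈⟨ x∙yz≈y∙xz (f Fin.zero) x _ ⟩
    x ∙ (f Fin.zero ∙ ∑ (allFin n) (f ∘ Fin.suc)) ≡⟨ ≡.cong (x ∙_) (≡.sym (∑-allFin-suc f)) ⟩
    x ∙ ∑ (allFin (suc n)) f                       ∎
    where
    open import Algebra.Properties.CommutativeSemigroup commutativeSemigroup using (x∙yz≈y∙xz)
    g = λ w → if does (w Fin.≟ Fin.suc v) then x ∙ f w else f w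

  ∑-upTo-δ : ∀ {n i} x → i < n → ∑ (upTo n) (λ j → if does (i ℕ.≟ j) then x else ε) ≈ x
  ∑-upTo-δ {suc n} {i} x i<n = ≡.subst (_≈ x) (≡.sym (∑-upTo-suc n _)) (split i i<n)
    where
    split : ∀ i → i < suc n →
            (if does (i ℕ.≟ 0) then x else ε) ∙ ∑ (upTo n) (λ j → if does (i ℕ.≟ suc j) then x else ε) ≈ x
    split zero    _         = trans (∙-congˡ (∑-ε (upTo n) (λ _ → refl))) (identityʳ x)
    split (suc i) (s≤s i<n) = trans (identityˡ _) (∑-upTo-δ x i<n)

module SemiringSum {c ℓ} (R : Semiring c ℓ) where
  open Semiring R
  open ListSum +-commutativeMonoid public

  ∑-*ˡ : ∀ (xs : List A) x f → x * ∑ xs f ≈ ∑ xs (λ y → x * f y)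
  ∑-*ˡ []       x f = zeroʳ x
  ∑-*ˡ (y ∷ xs) x f = trans (distribˡ x _ _) (+-congˡ (∑-*ˡ xs x f))

  ∑-*ʳ : ∀ (xs : List A) x f → ∑ xs f * x ≈ ∑ xs (λ y → f y * x)
  ∑-*ʳ []       x f = zeroˡ x
  ∑-*ʳ (y ∷ xs) x f = trans (distribʳ x _ _) (+-congˡ (∑-*ʳ xs x f))

index-conditions : ∀ {n J K c r ρ : ℕ} {t : ℤ} → K ≤ n → c ℕ.+ ρ ≡ n → + r ≡ + (2 ℕ.* n) ℤ.+ t →
                   (r ≡ J × c ≡ K) ⇔ (ρ ≡ n ∸ K × t ≡ + J - + (2 ℕ.* n))
index-conditions {n} {J} {K} {c} {r} {ρ} {t} K≤n c+ρ≡n r≡2n+t = mk⇔ to from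
  where
  open ≡.≡-Reasoning
  to : r ≡ J × c ≡ K → ρ ≡ n ∸ K × t ≡ + J - + (2 ℕ.* n)
  to (≡.refl , ≡.refl) = ≡.trans (≡.sym (ℕ.m+n∸m≡n c ρ)) (≡.cong (_∸ c) c+ρ≡n) , (begin
    t                                  ≡⟨ cancel (+ (2 ℕ.* n)) t ⟩
    (+ (2 ℕ.* n) ℤ.+ t) - + (2 ℕ.* n)  ≡⟨ ≡.cong (_- + (2 ℕ.* n)) (≡.sym r≡2n+t) ⟩
    + r - + (2 ℕ.* n)                  ∎)
    where
    cancel : ∀ A T → T ≡ (A ℤ.+ T) - A
    cancel = ℤ-Solver.solve-∀
  from : ρ ≡ n ∸ K × t ≡ + J - + (2 ℕ.* n) → r ≡ J × c ≡ K
  from (≡.refl , ≡.refl) = ℤ.+-injective (≡.trans r≡2n+t (add-back (+ (2 ℕ.* n)) (+ J))) , (begin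
    c                  ≡⟨ ≡.sym (ℕ.m+n∸n≡m c ρ) ⟩
    c ℕ.+ ρ ∸ ρ        ≡⟨ ≡.cong (_∸ ρ) c+ρ≡n ⟩
    n ∸ (n ∸ K)        ≡⟨ ℕ.m∸[m∸n]≡n K≤n ⟩
    K                  ∎)
    where
    add-back : ∀ A B → A ℤ.+ (B - A) ≡ B
    add-back = ℤ-Solver.solve-∀

ladder : ℕ → ℕ → List ℕ
ladder h zero    = []
ladder h (suc m) = h ∷ ladder (2 ℕ.+ h) m

length-ladder : ∀ h m → List.length (ladder h m) ≡ m
length-ladder h zero    = ≡.refl
length-ladder h (suc m) = ≡.cong suc (length-ladder (2 ℕ.+ h) m)

applyUpTo≡ladder : ∀ {h} m (f : ℕ → ℕ) → (∀ i → f i ≡ h ℕ.+ 2 ℕ.* i) → List.applyUpTo f m ≡ ladder h m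
applyUpTo≡ladder         zero    f f≡ = ≡.refl
applyUpTo≡ladder {h} (suc m) f f≡ =
  ≡.cong₂ _∷_ (≡.trans (f≡ 0) (ℕ.+-identityʳ h))
              (applyUpTo≡ladder m (f ∘ suc) (λ i → ≡.trans (f≡ (suc i)) (lemma h i)))
  where
  lemma : ∀ h i → h ℕ.+ 2 ℕ.* suc i ≡ (2 ℕ.+ h) ℕ.+ 2 ℕ.* i
  lemma = ℕ-Solver.solve-∀

reverse-lahBoard : ∀ n → List.reverse (lahBoard n) ≡ ladder 0 n
reverse-lahBoard n = ≡.trans (List.reverse-involutive _)
  (≡.trans (List.map-upTo _ n) (applyUpTo≡ladder n _ (λ _ → ≡.refl)))

_==_ : ∀ {n} → Vec ℕ n → Vec ℕ n → Bool
u == v = does (Vec.≡-dec ℕ._≟_ u v)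

lookup≤sum : ∀ {n} (v : Vec ℕ n) i → Vec.lookup v i ≤ Vec.sum v
lookup≤sum (x ∷ v) Fin.zero    = ℕ.m≤m+n x _
lookup≤sum (x ∷ v) (Fin.suc i) = ℕ.≤-trans (lookup≤sum v i) (ℕ.m≤n+m _ x)

module PlacementTypes {c ℓ} (R : CommutativeRing c ℓ) (q : CommutativeRing.Carrier R)
                      (s : ℕ) (α : Fin (suc s) → CommutativeRing.Carrier R) where
  open Lah R q s α using (Choice; none; rook; typeOf; placementsR)

  rooksOfWeight : Fin (suc s) → List Choice → ℕ
  rooksOfWeight w []             = 0
  rooksOfWeight w (none ∷ φ)     = rooksOfWeight w φ
  rooksOfWeight w (rook v _ ∷ φ) = if does (w Fin.≟ v) then suc (rooksOfWeight w φ) else rooksOfWeight w φ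

  -- The filter predicate of typeOf is local to Defs, so it enters only through its two defining equations.
  length-filterᵇ : ∀ w (p : Choice → Bool) → p none ≡ false → (∀ v x → p (rook v x) ≡ does (w Fin.≟ v)) →
                   ∀ φ → List.length (List.filterᵇ p φ) ≡ rooksOfWeight w φ
  length-filterᵇ w p p-none p-rook []             = ≡.refl
  length-filterᵇ w p p-none p-rook (none ∷ φ)     rewrite p-none = length-filterᵇ w p p-none p-rook φ
  length-filterᵇ w p p-none p-rook (rook v x ∷ φ) rewrite p-rook v x with does (w Fin.≟ v)
  ... | true  = ≡.cong suc (length-filterᵇ w p p-none p-rook φ)
  ... | false = length-filterᵇ w p p-none p-rook φ

  -- typeOf φ has length suc s, so its tabulate unfolds once and lookup∘tabulate applies only to the tail.
  lookup-typeOf : ∀ φ w → Vec.lookup (typeOf φ) w ≡ rooksOfWeight w φ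
  lookup-typeOf φ Fin.zero    = length-filterᵇ Fin.zero _ ≡.refl (λ _ _ → ≡.refl) φ
  lookup-typeOf φ (Fin.suc w) =
    ≡.trans (Vec.lookup∘tabulate _ w) (length-filterᵇ (Fin.suc w) _ ≡.refl (λ _ _ → ≡.refl) φ)

  placementsR-length : ∀ e hs → All (λ φ → List.length φ ≡ List.length hs) (placementsR e hs)
  placementsR-length e []       = ≡.refl ∷ []
  placementsR-length e (h ∷ hs) =
    All.++⁺ (extend none (placementsR-length e hs))
            (concatMap⁺ (allFin (suc s)) λ w → concatMap⁺ (map suc (upTo (clamp (+ h ℤ.+ e)))) λ p →
               extend (rook w p) (placementsR-length _ hs))
    where
    extend : ∀ c {φs} → All (λ φ → List.length φ ≡ List.length hs) φs →
             All (λ φ → List.length φ ≡ suc (List.length hs)) (map (c ∷_) φs)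
    extend c = All.map⁺ ∘ All.map (≡.cong suc)
    concatMap⁺ : ∀ {P : List Choice → Set} (xs : List A) {f : A → List (List Choice)} →
                 (∀ x → All P (f x)) → All P (List.concatMap f xs)
    concatMap⁺ xs Pf = All.concat⁺ (All.map⁺ (All.universal Pf xs))

  module RookFold {a ℓ′} (M : CommutativeMonoid a ℓ′) where
    open CommutativeMonoid M
    open ListSum M

    rookFold : (Fin (suc s) → Carrier) → List Choice → Carrier
    rookFold f []              = ε
    rookFold f (none ∷ φ)      = rookFold f φ
    rookFold f (rook w _ ∷ φ) = f w ∙ rookFold f φ

    ∑-rooksOfWeight : ∀ (f : Fin (suc s) → Carrier) (g : Fin (suc s) → ℕ → Carrier) →
                      (∀ w → g w 0 ≈ ε) → (∀ w n → g w (suc n) ≈ f w ∙ g w n) →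
                      ∀ φ → ∑ (allFin (suc s)) (λ w → g w (rooksOfWeight w φ)) ≈ rookFold f φ
    ∑-rooksOfWeight f g g0 gsuc []             = ∑-ε (allFin (suc s)) g0
    ∑-rooksOfWeight f g g0 gsuc (none ∷ φ)     = ∑-rooksOfWeight f g g0 gsuc φ
    ∑-rooksOfWeight f g g0 gsuc (rook v p ∷ φ) = begin
      ∑ (allFin (suc s)) (λ w → g w (rooksOfWeight w (rook v p ∷ φ)))
        ≈⟨ ∑-cong (allFin (suc s)) step ⟩
      ∑ (allFin (suc s)) (λ w → if does (w Fin.≟ v) then f v ∙ g w (rooksOfWeight w φ)
                                                   else g w (rooksOfWeight w φ))
        ≈⟨ ∑-allFin-δ v (f v) _ ⟩
      f v ∙ ∑ (allFin (suc s)) (λ w → g w (rooksOfWeight w φ))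
        ≈⟨ ∙-congˡ (∑-rooksOfWeight f g g0 gsuc φ) ⟩
      f v ∙ rookFold f φ ∎
      where
      open import Relation.Binary.Reasoning.Setoid setoid
      step : ∀ w → g w (rooksOfWeight w (rook v p ∷ φ))
             ≈ (if does (w Fin.≟ v) then f v ∙ g w (rooksOfWeight w φ) else g w (rooksOfWeight w φ))
      step w with w Fin.≟ v
      ... | yes ≡.refl = gsuc w _
      ... | no _       = refl

    ∑-typeOf : ∀ (f : Fin (suc s) → Carrier) (g : Fin (suc s) → ℕ → Carrier) →
               (∀ w → g w 0 ≈ ε) → (∀ w n → g w (suc n) ≈ f w ∙ g w n) →
               ∀ φ → ∑ (allFin (suc s)) (λ w → g w (Vec.lookup (typeOf φ) w)) ≈ rookFold f φ
    ∑-typeOf f g g0 gsuc φ =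
      trans (∑-cong (allFin (suc s)) (λ w → reflexive (≡.cong (g w) (lookup-typeOf φ w))))
            (∑-rooksOfWeight f g g0 gsuc φ)

module LahProof {c ℓ} (R : CommutativeRing c ℓ) (q : CommutativeRing.Carrier R)
                (s : ℕ) (α : Fin (suc s) → CommutativeRing.Carrier R) where
  open CommutativeRing R hiding (_-_)
  open Lah R q s α
  open PlacementTypes R q s α
  open SemiringSum semiring
  open import Algebra.Properties.CommutativeSemigroup *-commutativeSemigroup
    using (x∙yz≈y∙xz)
  open import Relation.Binary.Reasoning.Setoid setoid

  allR : List (Fin (suc s))
  allR = allFin (suc s)

  [_]q : ℕ → Carrier
  [ m ]q = ∑ (upTo m) (pow q)

  [suc]q : ∀ m → [ suc m ]q ≈ 1# + q * [ m ]q
  [suc]q m = begin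
    [ suc m ]q                         ≡⟨ ∑-upTo-suc m (pow q) ⟩
    1# + ∑ (upTo m) (λ i → q * pow q i) ≈⟨ +-congˡ (sym (∑-*ˡ (upTo m) q (pow q))) ⟩
    1# + q * [ m ]q                    ∎

  Test : Set c
  Test = ℕ → ℕ → Carrier

  ⟪_,_⟫ : Expr → Test → Carrier
  ⟪ E , F ⟫ = ∑ E (λ (d , a , b) → d * F a b)

  ⟪⟫-cong : ∀ E {F G : Test} → (∀ a b → F a b ≈ G a b) → ⟪ E , F ⟫ ≈ ⟪ E , G ⟫
  ⟪⟫-cong E F≈G = ∑-cong E (λ (d , a , b) → *-congˡ (F≈G a b))

  ⟪⟫-+ : ∀ E (F G : Test) → ⟪ E , (λ a b → F a b + G a b) ⟫ ≈ ⟪ E , F ⟫ + ⟪ E , G ⟫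
  ⟪⟫-+ E F G = trans (∑-cong E (λ (d , a , b) → distribˡ d (F a b) (G a b))) (∑-distrib E _ _)

  ⟪⟫-* : ∀ E x (F : Test) → ⟪ E , (λ a b → x * F a b) ⟫ ≈ x * ⟪ E , F ⟫
  ⟪⟫-* E x F = trans (∑-cong E (λ (d , a , b) → x∙yz≈y∙xz d x (F a b))) (sym (∑-*ˡ E x _))

  ⟪⟫-∑ : ∀ E (xs : List A) (F : A → Test) →
         ⟪ E , (λ a b → ∑ xs (λ x → F x a b)) ⟫ ≈ ∑ xs (λ x → ⟪ E , F x ⟫)
  ⟪⟫-∑ E xs F = trans (∑-cong E (λ (d , a , b) → ∑-*ˡ xs d _)) (∑-comm E xs _)

  ⟪⟫-0 : ∀ E {F : Test} → (∀ a b → F a b ≈ 0#) → ⟪ E , F ⟫ ≈ 0#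
  ⟪⟫-0 E F≈0 = ∑-ε E (λ (d , a , b) → trans (*-congˡ (F≈0 a b)) (zeroʳ d))

  δ : ℕ → ℕ → Carrier
  δ i a = if does (a ℕ.≟ i) then 1# else 0#

  coord : ℕ → ℕ → Test
  coord j k a b = δ j a * δ k b

  coeff≈⟪coord⟫ : ∀ E j k → coeff E j k ≈ ⟪ E , coord j k ⟫
  coeff≈⟪coord⟫ []                j k = refl
  coeff≈⟪coord⟫ ((d , a , b) ∷ E) j k with does (a ℕ.≟ j) | does (b ℕ.≟ k)
  ... | true  | true  = +-cong (sym (trans (*-congˡ (*-identityˡ 1#)) (*-identityʳ d))) (coeff≈⟪coord⟫ E j k)
  ... | true  | false = +-cong (sym (trans (*-congˡ (zeroʳ 1#)) (zeroʳ d))) (coeff≈⟪coord⟫ E j k)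
  ... | false | _     = +-cong (sym (trans (*-congˡ (zeroˡ _)) (zeroʳ d))) (coeff≈⟪coord⟫ E j k)

  δ-+ : ∀ d {j a} → δ (d ℕ.+ j) (d ℕ.+ a) ≡ δ j a
  δ-+ zero    = ≡.refl
  δ-+ (suc d) = δ-+ d

  δ-< : ∀ {j d} a → j < d → δ j (d ℕ.+ a) ≡ 0#
  δ-< {zero}  {suc d} a _         = ≡.refl
  δ-< {suc j} {suc d} a (s≤s j<d) = δ-< a j<d

  δ-sift : ∀ (f : ℕ → Carrier) j a → f a * δ j a ≈ f j * δ j a
  δ-sift f zero    zero    = refl
  δ-sift f zero    (suc a) = trans (zeroʳ _) (sym (zeroʳ _))
  δ-sift f (suc j) zero    = trans (zeroʳ _) (sym (zeroʳ _))
  δ-sift f (suc j) (suc a) = δ-sift (f ∘ suc) j a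

  ⟪⟫-sift : ∀ E (f : ℕ → Carrier) j k → ⟪ E , (λ a b → f a * coord j k a b) ⟫ ≈ f j * coeff E j k
  ⟪⟫-sift E f j k = begin
    ⟪ E , (λ a b → f a * coord j k a b) ⟫
      ≈⟨ ⟪⟫-cong E (λ a b → trans (sym (*-assoc _ _ _)) (*-congʳ (δ-sift f j a))) ⟩
    ⟪ E , (λ a b → (f j * δ j a) * δ k b) ⟫ ≈⟨ ⟪⟫-cong E (λ a b → *-assoc _ _ _) ⟩
    ⟪ E , (λ a b → f j * coord j k a b) ⟫ ≈⟨ ⟪⟫-* E (f j) (coord j k) ⟩
    f j * ⟪ E , coord j k ⟫               ≈⟨ *-congˡ (sym (coeff≈⟪coord⟫ E j k)) ⟩
    f j * coeff E j k                     ∎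

  Y† X† Y²X† : Test → Test
  Y† F j k   = F (suc j) k
  X† F j k   = ⟪ xY j , (λ a b → F a (b ℕ.+ k)) ⟫
  Y²X† F     = X† (Y† (Y† F))

  ⟪mulY⟫ : ∀ E F → ⟪ mulY E , F ⟫ ≡ ⟪ E , Y† F ⟫
  ⟪mulY⟫ E F = ∑-map _ E _

  ⟪mulX⟫ : ∀ E F → ⟪ mulX E , F ⟫ ≈ ⟪ E , X† F ⟫
  ⟪mulX⟫ E F = trans (∑-concatMap _ E _) (∑-cong E term)
    where
    term : ∀ ((d , j , k) : Carrier × ℕ × ℕ) →
           ∑ (map (λ (e , a , b) → (d * e , a , b ℕ.+ k)) (xY j)) (λ (e , a , b) → e * F a b) ≈ d * X† F j k
    term (d , j , k) = begin
      ∑ (map _ (xY j)) _                                 ≡⟨ ∑-map _ (xY j) _ ⟩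
      ∑ (xY j) (λ (e , a , b) → (d * e) * F a (b ℕ.+ k)) ≈⟨ ∑-cong (xY j) (λ _ → *-assoc _ _ _) ⟩
      ∑ (xY j) (λ (e , a , b) → d * (e * F a (b ℕ.+ k))) ≈⟨ sym (∑-*ˡ (xY j) d _) ⟩
      d * X† F j k                                        ∎

  ⟪mulY²X⟫ : ∀ E F → ⟪ mulY (mulY (mulX E)) , F ⟫ ≈ ⟪ E , Y²X† F ⟫
  ⟪mulY²X⟫ E F = begin
    ⟪ mulY (mulY (mulX E)) , F ⟫ ≡⟨ ⟪mulY⟫ (mulY (mulX E)) F ⟩
    ⟪ mulY (mulX E) , Y† F ⟫       ≡⟨ ⟪mulY⟫ (mulX E) (Y† F) ⟩
    ⟪ mulX E , Y† (Y† F) ⟫         ≈⟨ ⟪mulX⟫ E (Y† (Y† F)) ⟩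
    ⟪ E , Y²X† F ⟫                 ∎

  Y²X†^ : ℕ → Test → Test
  Y²X†^ zero    F = F
  Y²X†^ (suc n) F = Y²X†^ n (Y²X† F)

  Y²X†^-suc : ∀ n F j k → Y²X†^ (suc n) F j k ≡ Y²X† (Y²X†^ n F) j k
  Y²X†^-suc zero    F j k = ≡.refl
  Y²X†^-suc (suc n) F j k = Y²X†^-suc n (Y²X† F) j k

  ⟪lahWord⟫ : ∀ n F → ⟪ normal (lahWord n) , F ⟫ ≈ Y²X†^ n F 0 0
  ⟪lahWord⟫ zero    F = trans (+-identityʳ _) (*-identityˡ _)
  ⟪lahWord⟫ (suc n) F = trans (⟪mulY²X⟫ (normal (lahWord n)) F) (⟪lahWord⟫ n (Y²X† F))

  -- X Y^m = q^m Y^m X + [m]_q Σ_r α_r Y^(r+m-1); pairing with G shifted by one row avoids the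
  -- index r + m - 1 at m = 0.
  ⟪xY⟫ : ∀ m (G : Test) → ⟪ xY m , (λ a b → G (suc a) b) ⟫
         ≈ pow q m * G (suc m) 1 + ∑ allR (λ r → α r * ([ m ]q * G (toℕ r ℕ.+ m) 0))
  ⟪xY⟫ zero    G = begin
    1# * G 1 1 + 0#
      ≈⟨ +-congˡ (sym (∑-ε allR (λ r → trans (*-congˡ (zeroˡ _)) (zeroʳ _)))) ⟩
    1# * G 1 1 + ∑ allR (λ r → α r * (0# * G (toℕ r ℕ.+ 0) 0)) ∎
  ⟪xY⟫ (suc m) G = begin
    ⟪ xY (suc m) , G₁ ⟫
      ≈⟨ ∑-++ (map _ (xY m)) (map _ allR) _ ⟩
    ∑ (map _ (xY m)) (λ (d , a , b) → d * G₁ a b) + ∑ (map _ allR) (λ (d , a , b) → d * G₁ a b)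
      ≡⟨ ≡.cong₂ _+_ (∑-map _ (xY m) _) (∑-map _ allR _) ⟩
    ∑ (xY m) (λ (d , a , b) → (q * d) * G₂ a b) + ∑ allR (λ r → α r * G (suc (toℕ r ℕ.+ m)) 0)
      ≈⟨ +-congʳ (trans (∑-cong (xY m) (λ _ → *-assoc _ _ _)) (sym (∑-*ˡ (xY m) q _))) ⟩
    q * ⟪ xY m , G₂ ⟫ + ∑ allR (λ r → α r * G (suc (toℕ r ℕ.+ m)) 0)
      ≈⟨ +-congʳ (*-congˡ (⟪xY⟫ m (G ∘ suc))) ⟩
    q * (pow q m * G (2 ℕ.+ m) 1 + ∑ allR (λ r → α r * ([ m ]q * G (suc (toℕ r ℕ.+ m)) 0)))
      + ∑ allR (λ r → α r * G (suc (toℕ r ℕ.+ m)) 0)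
      ≈⟨ +-congʳ (trans (distribˡ q _ _) (+-cong (sym (*-assoc _ _ _)) (∑-*ˡ allR q _))) ⟩
    (pow q (suc m) * G (2 ℕ.+ m) 1 + ∑ allR (λ r → q * (α r * ([ m ]q * G (suc (toℕ r ℕ.+ m)) 0))))
      + ∑ allR (λ r → α r * G (suc (toℕ r ℕ.+ m)) 0)
      ≈⟨ +-assoc _ _ _ ⟩
    pow q (suc m) * G (2 ℕ.+ m) 1 + (∑ allR (λ r → q * (α r * ([ m ]q * G (suc (toℕ r ℕ.+ m)) 0)))
      + ∑ allR (λ r → α r * G (suc (toℕ r ℕ.+ m)) 0))
      ≈⟨ +-congˡ (sym (∑-distrib allR _ _)) ⟩
    pow q (suc m) * G (2 ℕ.+ m) 1
      + ∑ allR (λ r → q * (α r * ([ m ]q * G (suc (toℕ r ℕ.+ m)) 0)) + α r * G (suc (toℕ r ℕ.+ m)) 0)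
      ≈⟨ +-congˡ (∑-cong allR (λ r → collect (α r) (G (suc (toℕ r ℕ.+ m)) 0))) ⟩
    pow q (suc m) * G (2 ℕ.+ m) 1 + ∑ allR (λ r → α r * ([ suc m ]q * G (suc (toℕ r ℕ.+ m)) 0))
      ≈⟨ +-congˡ (∑-cong allR (λ r → reflexive
           (≡.cong (λ i → α r * ([ suc m ]q * G i 0)) (≡.sym (ℕ.+-suc (toℕ r) m))))) ⟩
    pow q (suc m) * G (suc (suc m)) 1 + ∑ allR (λ r → α r * ([ suc m ]q * G (toℕ r ℕ.+ suc m) 0)) ∎
    where
    G₁ G₂ : Test
    G₁ a b = G (suc a) b
    G₂ a b = G (suc (suc a)) b
    collect : ∀ x g → q * (x * ([ m ]q * g)) + x * g ≈ x * ([ suc m ]q * g)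
    collect x g = begin
      q * (x * ([ m ]q * g)) + x * g       ≈⟨ +-cong (x∙yz≈y∙xz q x _) (sym (*-congˡ (*-identityˡ g))) ⟩
      x * (q * ([ m ]q * g)) + x * (1# * g) ≈⟨ sym (distribˡ x _ _) ⟩
      x * (q * ([ m ]q * g) + 1# * g)       ≈⟨ *-congˡ (+-congʳ (sym (*-assoc q _ g))) ⟩
      x * ((q * [ m ]q) * g + 1# * g)       ≈⟨ *-congˡ (sym (distribʳ g _ _)) ⟩
      x * ((q * [ m ]q + 1#) * g)           ≈⟨ *-congˡ (*-congʳ (trans (+-comm _ _) (sym ([suc]q m)))) ⟩
      x * ([ suc m ]q * g)                  ∎

  Y²X†-expand : ∀ F m b → Y²X† F m b
                ≈ pow q m * F (2 ℕ.+ m) (suc b) + ∑ allR (λ r → α r * ([ m ]q * F (suc (toℕ r ℕ.+ m)) b))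
  Y²X†-expand F m b = ⟪xY⟫ m (λ a b′ → F (suc a) (b′ ℕ.+ b))

  +[1+d+j]-d-1≡j : ∀ d j → + suc (d ℕ.+ j) - + d - + 1 ≡ + j
  +[1+d+j]-d-1≡j d j = lemma (+ d) (+ j)
    where
    lemma : ∀ D J → (+ 1 ℤ.+ (D ℤ.+ J)) - D - + 1 ≡ J
    lemma = ℤ-Solver.solve-∀

  +j-[j+e]-1≡-[1+e] : ∀ j e → + j - + (j ℕ.+ e) - + 1 ≡ -[1+ e ]
  +j-[j+e]-1≡-[1+e] j e = lemma (+ j) (+ e)
    where
    lemma : ∀ J E → J - (J ℤ.+ E) - + 1 ≡ ℤ.- (+ 1 ℤ.+ E)
    lemma = ℤ-Solver.solve-∀

  ⟪lahWord⟫-Y²-part : ∀ n j k →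
    ⟪ normal (lahWord n) , (λ a b → pow q a * coord (2 ℕ.+ j) k (2 ℕ.+ a) (suc b)) ⟫
    ≈ pow q j * lah n (+ j) (+ k - + 1)
  ⟪lahWord⟫-Y²-part n j zero    =
    trans (⟪⟫-0 (normal (lahWord n)) (λ a b → trans (*-congˡ (zeroʳ _)) (zeroʳ _))) (sym (zeroʳ _))
  ⟪lahWord⟫-Y²-part n j (suc k) = ⟪⟫-sift (normal (lahWord n)) (pow q) j k

  ⟪lahWord⟫-α-part : ∀ n J k d →
    ⟪ normal (lahWord n) , (λ a b → [ a ]q * coord J k (suc (d ℕ.+ a)) b) ⟫
    ≈ qint (+ J - + d - + 1) * lah n (+ J - + d - + 1) (+ k)
  ⟪lahWord⟫-α-part n J k d with ℕ.<-≤-connex d J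
  ... | inj₁ d<J with (j , ≡.refl) ← ℕ.m≤n⇒∃[o]m+o≡n d<J rewrite +[1+d+j]-d-1≡j d j =
    trans (⟪⟫-cong (normal (lahWord n)) (λ a b →
             reflexive (≡.cong (λ x → [ a ]q * (x * δ k b)) (δ-+ (suc d)))))
          (⟪⟫-sift (normal (lahWord n)) [_]q j k)
  ... | inj₂ J≤d with (e , ≡.refl) ← ℕ.m≤n⇒∃[o]m+o≡n J≤d rewrite +j-[j+e]-1≡-[1+e] J e =
    trans (⟪⟫-0 (normal (lahWord n)) (λ a b →
             trans (*-congˡ (trans (*-congʳ (reflexive (δ-< a (s≤s (ℕ.m≤m+n J e))))) (zeroˡ _))) (zeroʳ _)))
          (sym (zeroʳ _))

  lah-recurrence : ∀ (n j k : ℕ) → 2 ≤ j →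
    lah (suc n) (+ j) (+ k) ≈
      (pow q (j ∸ 2) * lah n (+ (j ∸ 2)) (+ k - + 1)
       + sumL (map (λ r → α r * qint (+ j - + toℕ r - + 1) * lah n (+ j - + toℕ r - + 1) (+ k)) allR))
  lah-recurrence n 1 k (s≤s ())
  lah-recurrence n (suc (suc j)) k _ = begin
    lah (suc n) (+ J) (+ k)
      ≈⟨ coeff≈⟪coord⟫ (mulY (mulY (mulX N))) J k ⟩
    ⟪ mulY (mulY (mulX N)) , coord J k ⟫
      ≈⟨ ⟪mulY²X⟫ N (coord J k) ⟩
    ⟪ N , Y²X† (coord J k) ⟫
      ≈⟨ ⟪⟫-cong N (Y²X†-expand (coord J k)) ⟩
    ⟪ N , (λ a b → Y²-part a b + ∑ allR (λ r → α r * α-part r a b)) ⟫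
      ≈⟨ trans (⟪⟫-+ N _ _) (+-congˡ (⟪⟫-∑ N allR _)) ⟩
    ⟪ N , Y²-part ⟫ + ∑ allR (λ r → ⟪ N , (λ a b → α r * α-part r a b) ⟫)
      ≈⟨ +-cong (⟪lahWord⟫-Y²-part n j k) (∑-cong allR (λ r → trans (⟪⟫-* N (α r) (α-part r))
           (trans (*-congˡ (⟪lahWord⟫-α-part n J k (toℕ r))) (sym (*-assoc _ _ _))))) ⟩
    pow q j * lah n (+ j) (+ k - + 1)
      + ∑ allR (λ r → α r * qint (+ J - + toℕ r - + 1) * lah n (+ J - + toℕ r - + 1) (+ k)) ∎
    where
    J = suc (suc j)
    N = normal (lahWord n)
    Y²-part : Test
    Y²-part a b = pow q a * coord J k (2 ℕ.+ a) (suc b)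
    α-part : Fin (suc s) → Test
    α-part r a b = [ a ]q * coord J k (suc (toℕ r ℕ.+ a)) b

  module ℕRooks = RookFold ℕ.+-0-commutativeMonoid
  module ℤRooks = RookFold ℤ.+-0-commutativeMonoid
  module ×Rooks = RookFold *-commutativeMonoid

  rookWeight : List Choice → Carrier
  rookWeight = ×Rooks.rookFold α

  rowIndex colIndex : ℕ → List Choice → ℕ
  rowIndex j []             = j
  rowIndex j (none ∷ φ)     = rowIndex (2 ℕ.+ j) φ
  rowIndex j (rook w _ ∷ φ) = rowIndex (suc (toℕ w ℕ.+ j)) φ
  colIndex k []             = k
  colIndex k (none ∷ φ)     = colIndex (suc k) φ
  colIndex k (rook _ _ ∷ φ) = colIndex k φ

  placementWeight : ℤ → List ℕ → ℕ → ℕ → Test → List Choice → Carrier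
  placementWeight e hs j k F φ = pow q (emptyR e hs φ) * (rookWeight φ * F (rowIndex j φ) (colIndex k φ))

  shift : ℤ → Fin (suc s) → ℤ
  shift e w = e ℤ.+ (+ toℕ w - + 1)

  pow-+ : ∀ a b → pow q (a ℕ.+ b) ≈ pow q a * pow q b
  pow-+ zero    b = sym (*-identityˡ _)
  pow-+ (suc a) b = trans (*-congˡ (pow-+ a b)) (sym (*-assoc _ _ _))

  ∑-positions : ∀ a x → ∑ (map suc (upTo a)) (λ p → pow q (p ∸ 1) * x) ≈ [ a ]q * x
  ∑-positions a x = trans (reflexive (∑-map suc (upTo a) _)) (sym (∑-*ʳ (upTo a) x (pow q)))

  ∑-placementsR-∷ : ∀ e h hs j k F → clamp (+ h ℤ.+ e) ≡ j →
    ∑ (placementsR e (h ∷ hs)) (placementWeight e (h ∷ hs) j k F)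
    ≈ pow q j * ∑ (placementsR e hs) (placementWeight e hs (2 ℕ.+ j) (suc k) F)
      + ∑ allR (λ w → α w * ([ j ]q * ∑ (placementsR (shift e w) hs)
                                         (placementWeight (shift e w) hs (suc (toℕ w ℕ.+ j)) k F)))
  ∑-placementsR-∷ e h hs j k F available = begin
    ∑ (map (none ∷_) (placementsR e hs) ++ List.concatMap rooks allR) f
      ≈⟨ ∑-++ (map (none ∷_) (placementsR e hs)) (List.concatMap rooks allR) f ⟩
    ∑ (map (none ∷_) (placementsR e hs)) f + ∑ (List.concatMap rooks allR) f
      ≈⟨ +-cong empty-column (trans (∑-concatMap rooks allR f) (∑-cong allR rook-column)) ⟩
    pow q j * Σ e (2 ℕ.+ j) (suc k) + ∑ allR (λ w → α w * ([ j ]q * Σ (shift e w) (suc (toℕ w ℕ.+ j)) k)) ∎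
    where
    f = placementWeight e (h ∷ hs) j k F
    Σ : ℤ → ℕ → ℕ → Carrier
    Σ e′ j′ k′ = ∑ (placementsR e′ hs) (placementWeight e′ hs j′ k′ F)
    positions = map suc (upTo (clamp (+ h ℤ.+ e)))
    rooks : Fin (suc s) → List (List Choice)
    rooks w = List.concatMap (λ p → map (rook w p ∷_) (placementsR (shift e w) hs)) positions

    empty-column : ∑ (map (none ∷_) (placementsR e hs)) f ≈ pow q j * Σ e (2 ℕ.+ j) (suc k)
    empty-column = begin
      ∑ (map (none ∷_) (placementsR e hs)) f
        ≡⟨ ∑-map (none ∷_) (placementsR e hs) f ⟩
      ∑ (placementsR e hs) (λ φ → f (none ∷ φ))
        ≈⟨ ∑-cong (placementsR e hs) split ⟩
      ∑ (placementsR e hs) (λ φ → pow q j * placementWeight e hs (2 ℕ.+ j) (suc k) F φ)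
        ≈⟨ sym (∑-*ˡ (placementsR e hs) (pow q j) _) ⟩
      pow q j * Σ e (2 ℕ.+ j) (suc k) ∎
      where
      split : ∀ φ → f (none ∷ φ) ≈ pow q j * placementWeight e hs (2 ℕ.+ j) (suc k) F φ
      split φ = trans (*-congʳ (trans (reflexive (≡.cong (λ a → pow q (a ℕ.+ emptyR e hs φ)) available))
                                     (pow-+ j (emptyR e hs φ))))
                      (*-assoc _ _ _)

    rook-column : ∀ w → ∑ (rooks w) f ≈ α w * ([ j ]q * Σ (shift e w) (suc (toℕ w ℕ.+ j)) k)
    rook-column w = begin
      ∑ (rooks w) f
        ≈⟨ ∑-concatMap _ positions f ⟩
      ∑ positions (λ p → ∑ (map (rook w p ∷_) (placementsR (shift e w) hs)) f)
        ≈⟨ ∑-cong positions at-position ⟩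
      ∑ positions (λ p → pow q (p ∸ 1) * (α w * Σ (shift e w) (suc (toℕ w ℕ.+ j)) k))
        ≈⟨ ∑-positions (clamp (+ h ℤ.+ e)) _ ⟩
      [ clamp (+ h ℤ.+ e) ]q * (α w * Σ (shift e w) (suc (toℕ w ℕ.+ j)) k)
        ≈⟨ trans (reflexive (≡.cong (λ a → [ a ]q * (α w * Σ (shift e w) (suc (toℕ w ℕ.+ j)) k)) available))
                 (x∙yz≈y∙xz _ _ _) ⟩
      α w * ([ j ]q * Σ (shift e w) (suc (toℕ w ℕ.+ j)) k) ∎
      where
      split : ∀ p φ → f (rook w p ∷ φ)
                      ≈ pow q (p ∸ 1) * (α w * placementWeight (shift e w) hs (suc (toℕ w ℕ.+ j)) k F φ)
      split p φ = begin
        pow q (p ∸ 1 ℕ.+ E) * ((α w * rookWeight φ) * V)    ≈⟨ *-congʳ (pow-+ (p ∸ 1) E) ⟩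
        (pow q (p ∸ 1) * pow q E) * ((α w * rookWeight φ) * V) ≈⟨ *-assoc _ _ _ ⟩
        pow q (p ∸ 1) * (pow q E * ((α w * rookWeight φ) * V)) ≈⟨ *-congˡ (*-congˡ (*-assoc _ _ _)) ⟩
        pow q (p ∸ 1) * (pow q E * (α w * (rookWeight φ * V))) ≈⟨ *-congˡ (x∙yz≈y∙xz _ _ _) ⟩
        pow q (p ∸ 1) * (α w * (pow q E * (rookWeight φ * V))) ∎
        where
        E = emptyR (shift e w) hs φ
        V = F (rowIndex (suc (toℕ w ℕ.+ j)) φ) (colIndex k φ)
      at-position : ∀ p → ∑ (map (rook w p ∷_) (placementsR (shift e w) hs)) f
                          ≈ pow q (p ∸ 1) * (α w * Σ (shift e w) (suc (toℕ w ℕ.+ j)) k)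
      at-position p = begin
        ∑ (map (rook w p ∷_) (placementsR (shift e w) hs)) f
          ≡⟨ ∑-map (rook w p ∷_) (placementsR (shift e w) hs) f ⟩
        ∑ (placementsR (shift e w) hs) (λ φ → f (rook w p ∷ φ))
          ≈⟨ ∑-cong (placementsR (shift e w) hs) (split p) ⟩
        ∑ (placementsR (shift e w) hs)
          (λ φ → pow q (p ∸ 1) * (α w * placementWeight (shift e w) hs (suc (toℕ w ℕ.+ j)) k F φ))
          ≈⟨ sym (trans (*-congˡ (∑-*ˡ (placementsR (shift e w) hs) (α w) _))
                        (∑-*ˡ (placementsR (shift e w) hs) _ _)) ⟩
        pow q (p ∸ 1) * (α w * Σ (shift e w) (suc (toℕ w ℕ.+ j)) k) ∎

  -- e counts the rows created so far (Σ (w - 1) over the rooks placed), so + j ≡ + h + e says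
  -- that the column of height h has j available cells.
  ∑-placements-ladder : ∀ m h e j k F → + j ≡ + h ℤ.+ e →
    ∑ (placementsR e (ladder h m)) (placementWeight e (ladder h m) j k F) ≈ Y²X†^ m F j k
  ∑-placements-ladder zero    h e j k F _   = trans (+-identityʳ _) (trans (*-identityˡ _) (*-identityˡ _))
  ∑-placements-ladder (suc m) h e j k F inv = begin
    ∑ (placementsR e (h ∷ L)) (placementWeight e (h ∷ L) j k F)
      ≈⟨ ∑-placementsR-∷ e h L j k F (≡.cong clamp (≡.sym inv)) ⟩
    pow q j * ∑ (placementsR e L) (placementWeight e L (2 ℕ.+ j) (suc k) F)
      + ∑ allR (λ w → α w * ([ j ]q * ∑ (placementsR (shift e w) L)
                                         (placementWeight (shift e w) L (suc (toℕ w ℕ.+ j)) k F)))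
      ≈⟨ +-cong (*-congˡ (∑-placements-ladder m (2 ℕ.+ h) e (2 ℕ.+ j) (suc k) F inv-none))
                (∑-cong allR (λ w → *-congˡ (*-congˡ
                  (∑-placements-ladder m (2 ℕ.+ h) (shift e w) (suc (toℕ w ℕ.+ j)) k F (inv-rook w))))) ⟩
    pow q j * Y²X†^ m F (2 ℕ.+ j) (suc k) + ∑ allR (λ w → α w * ([ j ]q * Y²X†^ m F (suc (toℕ w ℕ.+ j)) k))
      ≈⟨ sym (Y²X†-expand (Y²X†^ m F) j k) ⟩
    Y²X† (Y²X†^ m F) j k
      ≡⟨ ≡.sym (Y²X†^-suc m F j k) ⟩
    Y²X†^ (suc m) F j k ∎
    where
    L = ladder (2 ℕ.+ h) m

    inv-none : + (2 ℕ.+ j) ≡ + (2 ℕ.+ h) ℤ.+ e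
    inv-none = ≡.trans (≡.cong (λ x → + 2 ℤ.+ x) inv) (lemma (+ h) e)
      where
      lemma : ∀ H E → + 2 ℤ.+ (H ℤ.+ E) ≡ (+ 2 ℤ.+ H) ℤ.+ E
      lemma = ℤ-Solver.solve-∀

    inv-rook : ∀ w → + suc (toℕ w ℕ.+ j) ≡ + (2 ℕ.+ h) ℤ.+ shift e w
    inv-rook w = ≡.trans (≡.cong (λ x → + 1 ℤ.+ (+ toℕ w ℤ.+ x)) inv) (lemma (+ toℕ w) (+ h) e)
      where
      lemma : ∀ W H E → + 1 ℤ.+ (W ℤ.+ (H ℤ.+ E)) ≡ (+ 2 ℤ.+ H) ℤ.+ (E ℤ.+ (W - + 1))
      lemma = ℤ-Solver.solve-∀

  rookCount : List Choice → ℕ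
  rookCount = ℕRooks.rookFold (λ _ → 1)

  rookExcess : List Choice → ℤ
  rookExcess = ℤRooks.rookFold (λ w → + toℕ w - + 1)

  sum-typeOf : ∀ φ → Vec.sum (typeOf φ) ≡ rookCount φ
  sum-typeOf φ = ≡.trans (≡.sym (ListSum.∑-allFin-lookup ℕ.+-0-commutativeMonoid (typeOf φ)))
    (ℕRooks.∑-typeOf (λ _ → 1) (λ _ n → n) (λ _ → ≡.refl) (λ _ _ → ≡.refl) φ)

  wsum-typeOf : ∀ φ → wsum (typeOf φ) ≡ rookExcess φ
  wsum-typeOf = ℤRooks.∑-typeOf _ (λ w n → (+ toℕ w - + 1) ℤ.* + n)
    (λ w → ℤ.*-zeroʳ (+ toℕ w - + 1)) (λ w n → ℤ.*-suc (+ toℕ w - + 1) (+ n))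

  αpow-typeOf : ∀ φ → αpow (typeOf φ) ≈ rookWeight φ
  αpow-typeOf = ×Rooks.∑-typeOf α (λ w → pow (α w)) (λ _ → refl) (λ _ _ → refl)

  colIndex+rookCount : ∀ k φ → colIndex k φ ℕ.+ rookCount φ ≡ k ℕ.+ List.length φ
  colIndex+rookCount k []             = ≡.refl
  colIndex+rookCount k (none ∷ φ)     = ≡.trans (colIndex+rookCount (suc k) φ) (≡.sym (ℕ.+-suc k _))
  colIndex+rookCount k (rook _ _ ∷ φ) =
    ≡.trans (ℕ.+-suc (colIndex k φ) _) (≡.trans (≡.cong suc (colIndex+rookCount k φ)) (≡.sym (ℕ.+-suc k _)))

  rowIndex≡ : ∀ j φ → + rowIndex j φ ≡ + j ℤ.+ (+ (2 ℕ.* List.length φ) ℤ.+ rookExcess φ)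
  rowIndex≡ j []             = ≡.cong +_ (≡.sym (ℕ.+-identityʳ j))
  rowIndex≡ j (none ∷ φ)     rewrite ℕ.*-suc 2 (List.length φ) =
    ≡.trans (rowIndex≡ (2 ℕ.+ j) φ) (lemma (+ j) (+ (2 ℕ.* List.length φ)) (rookExcess φ))
    where
    lemma : ∀ J L E → (+ 2 ℤ.+ J) ℤ.+ (L ℤ.+ E) ≡ J ℤ.+ ((+ 2 ℤ.+ L) ℤ.+ E)
    lemma = ℤ-Solver.solve-∀
  rowIndex≡ j (rook w _ ∷ φ) rewrite ℕ.*-suc 2 (List.length φ) =
    ≡.trans (rowIndex≡ (suc (toℕ w ℕ.+ j)) φ) (lemma (+ toℕ w) (+ j) (+ (2 ℕ.* List.length φ)) (rookExcess φ))
    where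
    lemma : ∀ W J L E → (+ 1 ℤ.+ (W ℤ.+ J)) ℤ.+ (L ℤ.+ E) ≡ J ℤ.+ ((+ 2 ℤ.+ L) ℤ.+ ((W - + 1) ℤ.+ E))
    lemma = ℤ-Solver.solve-∀

  coord≈if : ∀ J K a b → coord J K a b ≈ (if does ((a ℕ.≟ J) ×-dec (b ℕ.≟ K)) then 1# else 0#)
  coord≈if J K a b with does (a ℕ.≟ J) | does (b ℕ.≟ K)
  ... | true  | true  = *-identityˡ 1#
  ... | true  | false = zeroʳ 1#
  ... | false | _     = zeroˡ _

  placementWeight-coord : ∀ {n} e hs J K φ → K ≤ n → List.length φ ≡ n →
    placementWeight e hs 0 0 (coord J K) φ
    ≈ (if does ((Vec.sum (typeOf φ) ℕ.≟ n ∸ K) ×-dec (wsum (typeOf φ) ℤ.≟ + J - + (2 ℕ.* n)))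
       then αpow (typeOf φ) * pow q (emptyR e hs φ) else 0#)
  placementWeight-coord {n} e hs J K φ K≤n len = begin
    pow q E * (rookWeight φ * coord J K (rowIndex 0 φ) (colIndex 0 φ))
      ≈⟨ *-congˡ (*-congˡ (coord≈if J K (rowIndex 0 φ) (colIndex 0 φ))) ⟩
    pow q E * (rookWeight φ * (if does indices? then 1# else 0#))
      ≡⟨ ≡.cong (λ b → pow q E * (rookWeight φ * (if b then 1# else 0#))) (does-⇔ conditions indices? type?) ⟩
    pow q E * (rookWeight φ * (if does type? then 1# else 0#))
      ≈⟨ scale (does type?) ⟩
    (if does type? then αpow (typeOf φ) * pow q E else 0#) ∎
    where
    E = emptyR e hs φ
    indices? = (rowIndex 0 φ ℕ.≟ J) ×-dec (colIndex 0 φ ℕ.≟ K)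
    type? = (Vec.sum (typeOf φ) ℕ.≟ n ∸ K) ×-dec (wsum (typeOf φ) ℤ.≟ + J - + (2 ℕ.* n))
    conditions : (rowIndex 0 φ ≡ J × colIndex 0 φ ≡ K)
                 ⇔ (Vec.sum (typeOf φ) ≡ n ∸ K × wsum (typeOf φ) ≡ + J - + (2 ℕ.* n))
    conditions rewrite sum-typeOf φ | wsum-typeOf φ =
      index-conditions K≤n (≡.trans (colIndex+rookCount 0 φ) len)
        (≡.trans (rowIndex≡ 0 φ) (≡.trans (ℤ.+-identityˡ _) (≡.cong (λ l → + (2 ℕ.* l) ℤ.+ rookExcess φ) len)))
    scale : ∀ b → pow q E * (rookWeight φ * (if b then 1# else 0#)) ≈ (if b then αpow (typeOf φ) * pow q E else 0#)
    scale true  = trans (*-congˡ (*-identityʳ _)) (trans (*-comm _ _) (*-congʳ (sym (αpow-typeOf φ))))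
    scale false = trans (*-congˡ (zeroʳ _)) (zeroʳ _)

  ∑-boundedVecs-δ : ∀ m a (v : Vec ℕ m) x → (∀ i → Vec.lookup v i ≤ a) →
                    ∑ (boundedVecs m a) (λ κ → if v == κ then x else 0#) ≈ x
  ∑-boundedVecs-δ zero    a []      x _       = +-identityʳ x
  ∑-boundedVecs-δ (suc m) a (y ∷ v) x bounded = begin
    ∑ (List.concatMap (λ y′ → map (y′ ∷_) (boundedVecs m a)) (upTo (suc a))) f
      ≈⟨ ∑-concatMap (λ y′ → map (y′ ∷_) (boundedVecs m a)) (upTo (suc a)) f ⟩
    ∑ (upTo (suc a)) (λ y′ → ∑ (map (y′ ∷_) (boundedVecs m a)) f)
      ≈⟨ ∑-cong (upTo (suc a)) (λ y′ →
           trans (reflexive (∑-map (y′ ∷_) (boundedVecs m a) f)) (tail-matches (does (y ℕ.≟ y′)))) ⟩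
    ∑ (upTo (suc a)) (λ y′ → if does (y ℕ.≟ y′) then x else 0#)
      ≈⟨ ∑-upTo-δ x (s≤s (bounded Fin.zero)) ⟩
    x ∎
    where
    f : Vec ℕ (suc m) → Carrier
    f κ = if (y ∷ v) == κ then x else 0#
    tail-matches : ∀ b → ∑ (boundedVecs m a) (λ κ → if b ∧ v == κ then x else 0#) ≈ (if b then x else 0#)
    tail-matches true  = ∑-boundedVecs-δ m a v x (bounded ∘ Fin.suc)
    tail-matches false = ∑-ε (boundedVecs m a) (λ _ → refl)

  ∑-WC-δ : ∀ (v : Vec ℕ (suc s)) a t x →
    ∑ (WC s a t) (λ κ → if v == κ then x else 0#)
    ≈ (if does ((Vec.sum v ℕ.≟ a) ×-dec (wsum v ℤ.≟ t)) then x else 0#)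
  ∑-WC-δ v a t x = begin
    ∑ (WC s a t) (λ κ → if v == κ then x else 0#)
      ≈⟨ ∑-filterᵇ inWC (boundedVecs (suc s) a) _ ⟩
    ∑ (boundedVecs (suc s) a) (λ κ → if inWC κ then (if v == κ then x else 0#) else 0#)
      ≈⟨ ∑-cong (boundedVecs (suc s) a) swap ⟩
    ∑ (boundedVecs (suc s) a) (λ κ → if v == κ then (if inWC v then x else 0#) else 0#)
      ≈⟨ count (does (Vec.sum v ℕ.≟ a)) (ℕ.≡ᵇ⇒≡ (Vec.sum v) a) ⟩
    (if inWC v then x else 0#) ∎
    where
    inWC : Vec ℕ (suc s) → Bool
    inWC κ = does (Vec.sum κ ℕ.≟ a) ∧ does (wsum κ ℤ.≟ t)
    swap : ∀ κ → (if inWC κ then (if v == κ then x else 0#) else 0#)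
                 ≈ (if v == κ then (if inWC v then x else 0#) else 0#)
    swap κ with Vec.≡-dec ℕ._≟_ v κ
    ... | yes ≡.refl = refl
    ... | no _       = reflexive (Bool.if-eta (inWC κ))
    count : ∀ b → (T b → Vec.sum v ≡ a) →
            ∑ (boundedVecs (suc s) a) (λ κ → if v == κ then (if b ∧ does (wsum v ℤ.≟ t) then x else 0#) else 0#)
            ≈ (if b ∧ does (wsum v ℤ.≟ t) then x else 0#)
    count true  sum≡a =
      ∑-boundedVecs-δ (suc s) a v _ (λ i → ≡.subst (Vec.lookup v i ≤_) (sum≡a _) (lookup≤sum v i))
    count false _     = ∑-ε (boundedVecs (suc s) a) (λ κ → reflexive (Bool.if-eta (v == κ)))

  m≈∑ : ∀ κ B → m κ B ≈ ∑ (placements B) (λ φ → if typeOf φ == κ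
                                                then αpow (typeOf φ) * pow q (emptyR (+ 0) (List.reverse B) φ) else 0#)
  m≈∑ κ B = begin
    αpow κ * ∑ (M κ B) g
      ≈⟨ *-congˡ (∑-filterᵇ _ (placements B) g) ⟩
    αpow κ * ∑ (placements B) (λ φ → if typeOf φ == κ then g φ else 0#)
      ≈⟨ ∑-*ˡ (placements B) (αpow κ) _ ⟩
    ∑ (placements B) (λ φ → αpow κ * (if typeOf φ == κ then g φ else 0#))
      ≈⟨ ∑-cong (placements B) pull ⟩
    ∑ (placements B) (λ φ → if typeOf φ == κ then αpow (typeOf φ) * g φ else 0#) ∎
    where
    g : List Choice → Carrier
    g φ = pow q (emptyR (+ 0) (List.reverse B) φ)
    pull : ∀ φ → αpow κ * (if typeOf φ == κ then g φ else 0#)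
                 ≈ (if typeOf φ == κ then αpow (typeOf φ) * g φ else 0#)
    pull φ with Vec.≡-dec ℕ._≟_ (typeOf φ) κ
    ... | yes ≡.refl = refl
    ... | no _       = zeroʳ _

  lah≈∑m : ∀ n J K → K ≤ n →
            lah n (+ J) (+ K) ≈ sumL (map (λ κ → m κ (lahBoard n)) (WC s (n ∸ K) (+ J - + (2 ℕ.* n))))
  lah≈∑m n J K K≤n = begin
    lah n (+ J) (+ K)
      ≈⟨ coeff≈⟪coord⟫ (normal (lahWord n)) J K ⟩
    ⟪ normal (lahWord n) , coord J K ⟫
      ≈⟨ ⟪lahWord⟫ n (coord J K) ⟩
    Y²X†^ n (coord J K) 0 0
      ≈⟨ sym placements-sum ⟩
    ∑ P (placementWeight (+ 0) hs 0 0 (coord J K))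
      ≈⟨ ∑-congᴬ (All.map (placementWeight-coord (+ 0) hs J K _ K≤n) lengths) ⟩
    ∑ P (λ φ → if inWC (typeOf φ) then G φ else 0#)
      ≈⟨ sym (∑-cong P (λ φ → ∑-WC-δ (typeOf φ) (n ∸ K) t (G φ))) ⟩
    ∑ P (λ φ → ∑ W (λ κ → if typeOf φ == κ then G φ else 0#))
      ≈⟨ ∑-comm P W _ ⟩
    ∑ W (λ κ → ∑ P (λ φ → if typeOf φ == κ then G φ else 0#))
      ≈⟨ sym (∑-cong W (λ κ → m≈∑ κ (lahBoard n))) ⟩
    ∑ W (λ κ → m κ (lahBoard n)) ∎
    where
    hs = List.reverse (lahBoard n)
    P  = placementsR (+ 0) hs
    t  = + J - + (2 ℕ.* n)
    W  = WC s (n ∸ K) t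
    inWC : Vec ℕ (suc s) → Bool
    inWC κ = does ((Vec.sum κ ℕ.≟ n ∸ K) ×-dec (wsum κ ℤ.≟ t))
    G : List Choice → Carrier
    G φ = αpow (typeOf φ) * pow q (emptyR (+ 0) hs φ)
    placements-sum : ∑ P (placementWeight (+ 0) hs 0 0 (coord J K)) ≈ Y²X†^ n (coord J K) 0 0
    placements-sum rewrite reverse-lahBoard n = ∑-placements-ladder n 0 (+ 0) 0 0 (coord J K) ≡.refl
    lengths : All (λ φ → List.length φ ≡ n) P
    lengths rewrite reverse-lahBoard n =
      All.map (λ len → ≡.trans len (length-ladder 0 n)) (placementsR-length (+ 0) (ladder 0 n))

open import Data.Nat using (_*_)

proposition4p16 : ∀ {c ℓ} (R : CommutativeRing c ℓ) (q : CommutativeRing.Carrier R)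
    (s : ℕ) (α : Fin (suc s) → CommutativeRing.Carrier R) →
    let open Lah R q s α in (∀ (n j k : ℕ) → 1 ≤ n → 1 ≤ k → k ≤ n →
          lah n (+ j) (+ k) ≈ᴿ sumL (map (λ κ → m κ (lahBoard n)) (WC s (n ∸ k) (+ j - + (2 * n)))))
       × (∀ (n j k : ℕ) → 2 ≤ j →
          lah (suc n) (+ j) (+ k) ≈ᴿ
            (pow q (j ∸ 2) *ᴿ lah n (+ (j ∸ 2)) (+ k - + 1)
             +ᴿ sumL (map (λ r → α r *ᴿ qint (+ j - + toℕ r - + 1) *ᴿ lah n (+ j - + toℕ r - + 1) (+ k))
                         (allFin (suc s)))))
-- Part (i) holds without the hypotheses 1 ≤ n and 1 ≤ k.
proposition4p16 R q s α = (λ n j k _ _ → lah≈∑m n j k) , lah-recurrence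
  where open LahProof R q s α
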